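{- Let $\mu\geq 2$. If $T=(X,\{T_1,\dots,T_\mu\})$ is a $\mu$-way $(v,3,2)$ trade, then for each $x\in \mathrm{found}(T)$, $r_x\geq \lceil\frac{\mu+1}{2}\rceil$.
   Context: A $(v,k,t)$ trade is a triple $(X;T_1,T_2)$ where $X$ is a $v$-set and $T_1,T_2$ are disjoint nonempty collections of $k$-subsets (blocks) of $X$ such that every $t$-subset of $X$ is contained in the same number of blocks of $T_1$ as of $T_2$. A $\mu$-way $(v,k,t)$ trade is a pair $T=(X,\{T_1,\dots,T_\mu\})$ such that for every $i\neq j$, $(X;T_i,T_j)$ is a $(v,k,t)$ trade. The volume is the common number of blocks of the $T_i$. The foundation $\mathrm{found}(T)$ is the set of elements of $X$ occurring in some block (the same for every $T_i$). For $x\in\mathrm{found}(T)$, $r_x$ denotes the number of blocks of $T_i$ containing $x$ (independent of $i$). -}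

module Defs where

open import Data.Nat using (ℕ; _≥_; ⌈_/2⌉; suc)
open import Data.Fin using (Fin)
open import Data.Fin.Subset using (Subset; ∣_∣; _⊆_) renaming (_∈_ to _∈ₛ_)
open import Data.Fin.Subset.Properties using (_⊆?_; _∈?_)
open import Data.List using (List; length; filter; [])
open import Data.List.Membership.Propositional using (_∈_; _∉_)
open import Data.List.Relation.Unary.Unique.Propositional using (Unique)
open import Data.List.Relation.Unary.Any using (Any)
open import Data.Product using (_×_; ∃)
open import Relation.Binary.PropositionalEquality using (_≡_; _≢_)
open import Relation.Nullary using (¬_)

Collection : ℕ → Set
Collection v = List (Subset v)

λ-count : ∀ {v} → Collection v → Subset v → ℕ
λ-count T S = length (filter (S ⊆?_) T)

IsBlockCollection : ∀ {v} → ℕ → Collection v → Set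
IsBlockCollection {v} k T = Unique T × (∀ (B : Subset v) → B ∈ T → ∣ B ∣ ≡ k)

IsTrade : (v k t : ℕ) → Collection v → Collection v → Set
IsTrade v k t T₁ T₂ =
  IsBlockCollection k T₁ × IsBlockCollection k T₂ ×
  (T₁ ≢ []) × (T₂ ≢ []) ×
  (∀ (B : Subset v) → B ∈ T₁ → B ∉ T₂) ×
  (∀ (S : Subset v) → ∣ S ∣ ≡ t → λ-count T₁ S ≡ λ-count T₂ S)

IsMultiTrade : (μ v k t : ℕ) → (Fin μ → Collection v) → Set
IsMultiTrade μ v k t T = ∀ (i j : Fin μ) → i ≢ j → IsTrade v k t (T i) (T j)

InFoundation : ∀ {μ v} → (Fin μ → Collection v) → Fin v → Set
InFoundation {μ} T x = ∃ λ (i : Fin μ) → Any (λ B → x ∈ₛ B) (T i)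

r : ∀ {v} → Collection v → Fin v → ℕ
r T x = length (filter (x ∈?_) T)

-- Let y be a second point of some block through x. All T i agree on pairs, so every T i has a
-- block {x, y, z i}; these blocks lie in pairwise disjoint collections and a 3-set is determined
-- by its three points, so the z i are distinct. Thus y, z 1, …, z μ are μ + 1 points each paired
-- with x in a block of T i, while each of the r x blocks of T i through x contains only two
-- points besides x; hence 2 r x ≥ μ + 1.
module Submission where

open import Defs
open import Data.Nat using (ℕ; suc; _+_; _*_; _≤_; _<_; _≥_; z≤n; s≤s; ⌈_/2⌉; _<?_)
open import Data.Nat.Properties
  using (≤-trans; ≤-reflexive; ≤-pred; ≤-antisym; <⇒≱; n≤1+n; +-mono-≤; +-monoʳ-≤;
         +-comm; +-suc; +-identityʳ; *-suc; ⌈n/2⌉-mono; n≡⌈n+n/2⌉; module ≤-Reasoning)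
open import Data.Fin using (Fin; zero; suc)
open import Data.Fin.Properties using (any?) renaming (_≟_ to _≟ᶠ_)
open import Data.Fin.Subset using (Subset; ∣_∣; _⊆_; _∪_; ⁅_⁆; ⊥; inside; outside)
  renaming (_∈_ to _∈ₛ_; _∉_ to _∉ₛ_)
open import Data.Fin.Subset.Properties
  using (_∈?_; _⊆?_; ⊆-refl; x∈p∪q⁺; x∈p∪q⁻; x∈⁅x⁆; x∈⁅y⁆⇒x≡y; ⊆-antisym;
         x∈p∧x≢y⇒x∈p-y; x∈p⇒∣p-x∣<∣p∣; ∣⊥∣≡0; ∣⁅x⁆∣≡1; p⊆q⇒∣p∣≤∣q∣)
open import Data.Vec using ([]; _∷_; here; there)
open import Data.List using (List; []; _∷_; length; filter; tabulate; foldr)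
open import Data.List.Properties using (filter-accept; filter-reject; filter-some; length-tabulate)
open import Data.List.Membership.Propositional using (_∈_; _∉_; find; lose)
open import Data.List.Membership.Propositional.Properties using (∈-filter⁻)
open import Data.List.Relation.Unary.All as All using (All; []; _∷_)
open import Data.List.Relation.Unary.All.Properties using (¬Any⇒All¬; all-filter; tabulate⁺)
  renaming (filter⁺ to All-filter⁺)
open import Data.List.Relation.Unary.Any using (Any; here; there)
  renaming (any? to Any-any?)
open import Data.List.Relation.Unary.Unique.Propositional using (Unique; []; _∷_)
open import Data.List.Relation.Unary.Unique.Propositional.Properties using ()
  renaming (filter⁺ to Unique-filter⁺; tabulate⁺ to Unique-tabulate⁺)
open import Data.Product using (_×_; _,_; ∃; proj₁; proj₂)
open import Data.Sum using (inj₁; inj₂)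
open import Function using (_∘_)
open import Relation.Binary.PropositionalEquality
  using (_≡_; _≢_; refl; sym; trans; cong; cong₂; subst; ≢-sym)
open import Relation.Nullary using (¬_; Dec; yes; no; ¬?; contradiction)
open import Relation.Nullary.Decidable using (_×-dec_; decidable-stable)
open import Relation.Unary using (Decidable)
open import Relation.Unary.Properties using (∁?)

variable
  n : ℕ

∣p∪q∣≤∣p∣+∣q∣ : (p q : Subset n) → ∣ p ∪ q ∣ ≤ ∣ p ∣ + ∣ q ∣
∣p∪q∣≤∣p∣+∣q∣ []            []            = z≤n
∣p∪q∣≤∣p∣+∣q∣ (outside ∷ p) (outside ∷ q) = ∣p∪q∣≤∣p∣+∣q∣ p q
∣p∪q∣≤∣p∣+∣q∣ (outside ∷ p) (inside  ∷ q) =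
  ≤-trans (s≤s (∣p∪q∣≤∣p∣+∣q∣ p q)) (≤-reflexive (sym (+-suc ∣ p ∣ ∣ q ∣)))
∣p∪q∣≤∣p∣+∣q∣ (inside  ∷ p) (outside ∷ q) = s≤s (∣p∪q∣≤∣p∣+∣q∣ p q)
∣p∪q∣≤∣p∣+∣q∣ (inside  ∷ p) (inside  ∷ q) =
  s≤s (≤-trans (∣p∪q∣≤∣p∣+∣q∣ p q) (+-monoʳ-≤ ∣ p ∣ (n≤1+n ∣ q ∣)))

elements : List (Fin n) → Subset n
elements = foldr (λ x p → ⁅ x ⁆ ∪ p) ⊥

∈⇒∈elements : {x : Fin n} {xs : List (Fin n)} → x ∈ xs → x ∈ₛ elements xs
∈⇒∈elements (here refl)  = x∈p∪q⁺ (inj₁ (x∈⁅x⁆ _))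
∈⇒∈elements (there x∈xs) = x∈p∪q⁺ (inj₂ (∈⇒∈elements x∈xs))

∣elements∣≤length : (xs : List (Fin n)) → ∣ elements xs ∣ ≤ length xs
∣elements∣≤length {n} []       = ≤-reflexive (∣⊥∣≡0 n)
∣elements∣≤length      (x ∷ xs) = begin
  ∣ ⁅ x ⁆ ∪ elements xs ∣          ≤⟨ ∣p∪q∣≤∣p∣+∣q∣ ⁅ x ⁆ (elements xs) ⟩
  ∣ ⁅ x ⁆ ∣ + ∣ elements xs ∣      ≡⟨ cong (_+ ∣ elements xs ∣) (∣⁅x⁆∣≡1 x) ⟩
  suc ∣ elements xs ∣              ≤⟨ s≤s (∣elements∣≤length xs) ⟩
  suc (length xs)                  ∎
  where open ≤-Reasoning

∣p∣≤length : (p : Subset n) (xs : List (Fin n)) → (∀ {y} → y ∈ₛ p → y ∈ xs) → ∣ p ∣ ≤ length xs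
∣p∣≤length p xs p⊆xs = ≤-trans (p⊆q⇒∣p∣≤∣q∣ (∈⇒∈elements ∘ p⊆xs)) (∣elements∣≤length xs)

Unique⇒length≤∣p∣ : {p : Subset n} {xs : List (Fin n)} →
  Unique xs → All (_∈ₛ p) xs → length xs ≤ ∣ p ∣
Unique⇒length≤∣p∣ []         []           = z≤n
Unique⇒length≤∣p∣ (x∉xs ∷ u) (x∈p ∷ xs⊆p) =
  ≤-trans (s≤s (Unique⇒length≤∣p∣ u xs⊆p-x)) (x∈p⇒∣p-x∣<∣p∣ x∈p)
  where
  xs⊆p-x = All.zipWith (λ (y∈p , x≢y) → x∈p∧x≢y⇒x∈p-y y∈p (≢-sym x≢y)) (xs⊆p , x∉xs)

length<∣p∣⇒∃∉ : (p : Subset n) (xs : List (Fin n)) → length xs < ∣ p ∣ → ∃ λ y → y ∈ₛ p × y ∉ xs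
length<∣p∣⇒∃∉ p xs xs<p with any? (λ y → y ∈? p ×-dec ¬? (Any-any? (y ≟ᶠ_) xs))
... | yes fresh = fresh
... | no ¬fresh = contradiction (∣p∣≤length p xs p⊆xs) (<⇒≱ xs<p)
  where
  p⊆xs : ∀ {y} → y ∈ₛ p → y ∈ xs
  p⊆xs {y} y∈p = decidable-stable (Any-any? (y ≟ᶠ_) xs) (λ y∉xs → ¬fresh (y , y∈p , y∉xs))

spanned⊆ : {p q : Subset n} {xs : List (Fin n)} → Unique xs → ∣ p ∣ ≤ length xs →
  All (_∈ₛ p) xs → All (_∈ₛ q) xs → p ⊆ q
spanned⊆ {xs = xs} u p≤xs xs⊆p xs⊆q {y} y∈p with Any-any? (y ≟ᶠ_) xs
... | yes y∈xs = All.lookup xs⊆q y∈xs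
... | no  y∉xs =
  contradiction (Unique⇒length≤∣p∣ (¬Any⇒All¬ xs y∉xs ∷ u) (y∈p ∷ xs⊆p)) (<⇒≱ (s≤s p≤xs))

≡-spanned : {p q : Subset n} {xs : List (Fin n)} →
  Unique xs → ∣ p ∣ ≡ length xs → ∣ q ∣ ≡ length xs → All (_∈ₛ p) xs → All (_∈ₛ q) xs → p ≡ q
≡-spanned u ∣p∣≡ ∣q∣≡ xs⊆p xs⊆q =
  ⊆-antisym (spanned⊆ u (≤-reflexive ∣p∣≡) xs⊆p xs⊆q) (spanned⊆ u (≤-reflexive ∣q∣≡) xs⊆q xs⊆p)

pair : Fin n → Fin n → Subset n
pair x y = ⁅ x ⁆ ∪ ⁅ y ⁆

pair⊆ : {x y : Fin n} {B : Subset n} → x ∈ₛ B → y ∈ₛ B → pair x y ⊆ B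
pair⊆ {x = x} {y} x∈B y∈B z∈pair with x∈p∪q⁻ ⁅ x ⁆ ⁅ y ⁆ z∈pair
... | inj₁ z∈⁅x⁆ = subst (_∈ₛ _) (sym (x∈⁅y⁆⇒x≡y x z∈⁅x⁆)) x∈B
... | inj₂ z∈⁅y⁆ = subst (_∈ₛ _) (sym (x∈⁅y⁆⇒x≡y y z∈⁅y⁆)) y∈B

pair⊆⁻ : {x y : Fin n} {B : Subset n} → pair x y ⊆ B → x ∈ₛ B × y ∈ₛ B
pair⊆⁻ {x = x} {y} pair⊆B = pair⊆B (x∈p∪q⁺ (inj₁ (x∈⁅x⁆ x))) , pair⊆B (x∈p∪q⁺ (inj₂ (x∈⁅x⁆ y)))

∣pair∣≡2 : {x y : Fin n} → x ≢ y → ∣ pair x y ∣ ≡ 2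
∣pair∣≡2 {x = x} {y} x≢y = ≤-antisym
  (≤-trans (∣p∪q∣≤∣p∣+∣q∣ ⁅ x ⁆ ⁅ y ⁆) (≤-reflexive (cong₂ _+_ (∣⁅x⁆∣≡1 x) (∣⁅x⁆∣≡1 y))))
  (Unique⇒length≤∣p∣ ((x≢y ∷ []) ∷ [] ∷ []) (x∈pair ∷ y∈pair ∷ []))
  where
  x∈pair = proj₁ (pair⊆⁻ ⊆-refl)
  y∈pair = proj₂ (pair⊆⁻ ⊆-refl)

module _ {a p} {A : Set a} {P : A → Set p} (P? : Decidable P) where

  0<length-filter⇒Any : (xs : List A) → 0 < length (filter P? xs) → Any P xs
  0<length-filter⇒Any (x ∷ xs) pos with P? x
  ... | yes px = here px
  ... | no  _  = there (0<length-filter⇒Any xs pos)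

  length-filter+length-filter∁ : (xs : List A) →
    length (filter P? xs) + length (filter (∁? P?) xs) ≡ length xs
  length-filter+length-filter∁ []       = refl
  length-filter+length-filter∁ (x ∷ xs) with P? x
  ... | yes _ = cong suc (length-filter+length-filter∁ xs)
  ... | no  _ = trans (+-suc _ _) (cong suc (length-filter+length-filter∁ xs))

Covers : Collection n → Fin n → Fin n → Set
Covers T x y = 0 < λ-count T (pair x y)

covers⇒block : {T : Collection n} {x y : Fin n} → Covers T x y → ∃ λ B → B ∈ T × x ∈ₛ B × y ∈ₛ B
covers⇒block {T = T} {x} {y} cov with find (0<length-filter⇒Any (pair x y ⊆?_) T cov)
... | B , B∈T , pair⊆B = B , B∈T , pair⊆⁻ pair⊆B

block⇒covers : {T : Collection n} {x y : Fin n} {B : Subset n} →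
  B ∈ T → x ∈ₛ B → y ∈ₛ B → Covers T x y
block⇒covers {x = x} {y} B∈T x∈B y∈B = filter-some (pair x y ⊆?_) (lose B∈T (pair⊆ x∈B y∈B))

covers-∷⁻ : {L : Collection n} {x y : Fin n} {B : Subset n} →
  Covers (B ∷ L) x y → ¬ pair x y ⊆ B → Covers L x y
covers-∷⁻ {x = x} {y} cov pair⊈B =
  subst (0 <_) (cong length (filter-reject (pair x y ⊆?_) pair⊈B)) cov

r-∷-∉ : {L : Collection n} {x : Fin n} {B : Subset n} → x ∉ₛ B → r (B ∷ L) x ≡ r L x
r-∷-∉ {x = x} x∉B = cong length (filter-reject (x ∈?_) x∉B)

r-∷-∈ : {L : Collection n} {x : Fin n} {B : Subset n} → x ∈ₛ B → r (B ∷ L) x ≡ suc (r L x)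
r-∷-∈ {x = x} x∈B = cong length (filter-accept (x ∈?_) x∈B)

neighbours≤ : {k : ℕ} (x : Fin n) (L : Collection n) → (∀ B → B ∈ L → ∣ B ∣ ≡ suc k) →
  {ps : List (Fin n)} → Unique ps → All (x ≢_) ps → All (Covers L x) ps → length ps ≤ k * r L x
neighbours≤ x []      _    {[]}    _ _    _         = z≤n
neighbours≤ x []      _    {_ ∷ _} _ _    (() ∷ _)
neighbours≤ {k = k} x (B ∷ L) size {ps} u x≢ps cov = byMembership (x ∈? B)
  where
  open ≤-Reasoning
  size-L : ∀ B′ → B′ ∈ L → ∣ B′ ∣ ≡ suc k
  size-L B′ = size B′ ∘ there
  C? : Decidable (Covers L x)
  C? p = 0 <? λ-count L (pair x p)
  psL = filter C? ps
  psB = filter (∁? C?) ps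
  psL≤ : length psL ≤ k * r L x
  psL≤ = neighbours≤ x L size-L (Unique-filter⁺ C? u) (All-filter⁺ C? x≢ps) (all-filter C? ps)
  psB⊆B : All (_∈ₛ B) psB
  psB⊆B = All.tabulate λ {p} p∈psB →
    let p∈ps , ¬covL = ∈-filter⁻ (∁? C?) p∈psB
    in proj₂ (pair⊆⁻ (decidable-stable (pair x p ⊆? B) (¬covL ∘ covers-∷⁻ (All.lookup cov p∈ps))))
  psB≤k : x ∈ₛ B → length psB ≤ k
  psB≤k x∈B = ≤-pred (≤-trans
    (Unique⇒length≤∣p∣ (All-filter⁺ (∁? C?) x≢ps ∷ Unique-filter⁺ (∁? C?) u) (x∈B ∷ psB⊆B))
    (≤-reflexive (size B (here refl))))
  byMembership : Dec (x ∈ₛ B) → length ps ≤ k * r (B ∷ L) x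
  byMembership (no x∉B) = subst (λ m → length ps ≤ k * m) (sym (r-∷-∉ x∉B))
    (neighbours≤ x L size-L u x≢ps (All.map (λ c → covers-∷⁻ c (x∉B ∘ proj₁ ∘ pair⊆⁻)) cov))
  byMembership (yes x∈B) = begin
    length ps                        ≡⟨ sym (length-filter+length-filter∁ C? ps) ⟩
    length psL + length psB          ≤⟨ +-mono-≤ psL≤ (psB≤k x∈B) ⟩
    k * r L x + k                    ≡⟨ +-comm (k * r L x) k ⟩
    k + k * r L x                    ≡⟨ sym (*-suc k (r L x)) ⟩
    k * suc (r L x)                  ≡⟨ cong (k *_) (sym (r-∷-∈ x∈B)) ⟩
    k * r (B ∷ L) x                  ∎

m≤2n⇒⌈m/2⌉≤n : {m n : ℕ} → m ≤ 2 * n → ⌈ m /2⌉ ≤ n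
m≤2n⇒⌈m/2⌉≤n {m} {n} m≤2n = begin
  ⌈ m /2⌉      ≤⟨ ⌈n/2⌉-mono m≤2n ⟩
  ⌈ 2 * n /2⌉  ≡⟨ cong (λ k → ⌈ n + k /2⌉) (+-identityʳ n) ⟩
  ⌈ n + n /2⌉  ≡⟨ sym (n≡⌈n+n/2⌉ n) ⟩
  n            ∎
  where open ≤-Reasoning

another : {μ : ℕ} → μ ≥ 2 → (i : Fin μ) → ∃ (i ≢_)
another (s≤s (s≤s _)) zero    = suc zero , λ ()
another (s≤s (s≤s _)) (suc i) = zero , λ ()

module _ {μ v k : ℕ} {T : Fin μ → Collection v} (trade : IsMultiTrade μ v k 2 T) where

  block-size : μ ≥ 2 → ∀ i B → B ∈ T i → ∣ B ∣ ≡ k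
  block-size μ≥2 i with another μ≥2 i
  ... | j , i≢j = let (_ , sizes) , _ = trade i j i≢j in sizes

  blocks-disjoint : {i j : Fin μ} → i ≢ j → ∀ B → B ∈ T i → B ∉ T j
  blocks-disjoint {i} {j} i≢j = let _ , _ , _ , _ , disjoint , _ = trade i j i≢j in disjoint

  covers-transfer : {x y : Fin v} → x ≢ y → ∀ i j → Covers (T i) x y → Covers (T j) x y
  covers-transfer x≢y i j cov with i ≟ᶠ j
  ... | yes refl = cov
  ... | no  i≢j  = let _ , _ , _ , _ , _ , balanced = trade i j i≢j
                   in subst (0 <_) (balanced _ (∣pair∣≡2 x≢y)) cov

module Neighbourhood {μ v : ℕ} {T : Fin μ → Collection v}
  (trade : IsMultiTrade μ v 3 2 T) (μ≥2 : μ ≥ 2) {x : Fin v} (x∈found : InFoundation T x) where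

  size : ∀ i B → B ∈ T i → ∣ B ∣ ≡ 3
  size = block-size trade μ≥2

  point-outside : ∀ i B → B ∈ T i → (xs : List (Fin v)) → length xs < 3 → ∃ λ z → z ∈ₛ B × z ∉ xs
  point-outside i B B∈T xs xs<3 = length<∣p∣⇒∃∉ B xs (subst (length xs <_) (sym (size i B B∈T)) xs<3)

  partner : InFoundation T x → ∃ λ y → x ≢ y × ∀ i → Covers (T i) x y
  partner (j , x∈Tj) with find x∈Tj
  ... | B , B∈Tj , x∈B with point-outside j B B∈Tj (x ∷ []) (s≤s (s≤s z≤n))
  ... | y , y∈B , y∉[x] = y , x≢y , λ i → covers-transfer trade x≢y j i (block⇒covers B∈Tj x∈B y∈B)
    where
    x≢y : x ≢ y
    x≢y x≡y = y∉[x] (here (sym x≡y))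

  y : Fin v
  y = proj₁ (partner x∈found)

  x≢y : x ≢ y
  x≢y = proj₁ (proj₂ (partner x∈found))

  covered : ∀ i → Covers (T i) x y
  covered = proj₂ (proj₂ (partner x∈found))

  record BlockOnPair (i : Fin μ) : Set where
    field
      block       : Subset v
      block∈T     : block ∈ T i
      x∈block     : x ∈ₛ block
      y∈block     : y ∈ₛ block
      third       : Fin v
      third∈block : third ∈ₛ block
      third∉xy    : third ∉ x ∷ y ∷ []

  blockOnPair : ∀ i → BlockOnPair i
  blockOnPair i with covers⇒block (covered i)
  ... | B , B∈T , x∈B , y∈B with point-outside i B B∈T (x ∷ y ∷ []) (s≤s (s≤s (s≤s z≤n)))
  ... | z , z∈B , z∉xy = record
    { block = B ; block∈T = B∈T ; x∈block = x∈B ; y∈block = y∈B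
    ; third = z ; third∈block = z∈B ; third∉xy = z∉xy }

  open module OnPair i = BlockOnPair (blockOnPair i)

  x≢third : ∀ i → x ≢ third i
  x≢third i x≡z = third∉xy i (here (sym x≡z))

  y≢third : ∀ i → y ≢ third i
  y≢third i y≡z = third∉xy i (there (here (sym y≡z)))

  third-injective : {i j : Fin μ} → third i ≡ third j → i ≡ j
  third-injective {i} {j} third-i≡j with i ≟ᶠ j
  ... | yes i≡j = i≡j
  ... | no  i≢j = contradiction (subst (_∈ T j) (sym same-block) (block∈T j))
                                (blocks-disjoint trade i≢j (block i) (block∈T i))
    where
    same-block : block i ≡ block j
    same-block = ≡-spanned ((x≢y ∷ x≢third i ∷ []) ∷ (y≢third i ∷ []) ∷ [] ∷ [])
      (size i _ (block∈T i)) (size j _ (block∈T j))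
      (x∈block i ∷ y∈block i ∷ third∈block i ∷ [])
      (x∈block j ∷ y∈block j ∷ subst (_∈ₛ block j) (sym third-i≡j) (third∈block j) ∷ [])

  neighbours : List (Fin v)
  neighbours = y ∷ tabulate third

  length-neighbours : length neighbours ≡ suc μ
  length-neighbours = cong suc (length-tabulate third)

  neighbours-unique : Unique neighbours
  neighbours-unique = tabulate⁺ y≢third ∷ Unique-tabulate⁺ third-injective

  x≢neighbours : All (x ≢_) neighbours
  x≢neighbours = x≢y ∷ tabulate⁺ x≢third

  neighbours-covered : ∀ i → All (Covers (T i) x) neighbours
  neighbours-covered i = covered i ∷ tabulate⁺ λ j →
    covers-transfer trade (x≢third j) j i (block⇒covers (block∈T j) (x∈block j) (third∈block j))

corollary3p3 : (μ v : ℕ) → μ ≥ 2 → (T : Fin μ → Collection v) →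
    IsMultiTrade μ v 3 2 T →
    (x : Fin v) → InFoundation T x →
    (i : Fin μ) → r (T i) x ≥ ⌈ suc μ /2⌉
corollary3p3 μ v μ≥2 T trade x x∈found i =
  m≤2n⇒⌈m/2⌉≤n (subst (_≤ 2 * r (T i) x) length-neighbours
    (neighbours≤ x (T i) (size i) neighbours-unique x≢neighbours (neighbours-covered i)))
  where open Neighbourhood trade μ≥2 x∈found
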